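{- Let $(B,\vee,\wedge,\partial,0,1)$ be a finite Boolean algebra with $2^n$ elements, and fix an enumeration $a_1,\dots,a_{2^n}$ of its elements. Then: (i) $B$ has exactly $n$ ideals of cardinality $2^{n-1}$; (ii) for $n\ge 2$, if $I_1,\dots,I_n$ are these ideals, the linear subspace of $\mathbb{Z}_2^{2^n}$ spanned by their codewords $c_{I_1},\dots,c_{I_n}$ is a Hadamard code of type $[2^n,n,2^{n-1}]_2$, i.e. a binary linear code of length $2^n$, dimension $n$ and minimum distance $2^{n-1}$.
   Context: An ideal of a Boolean algebra $B$ is a nonempty subset $I\subseteq B$ such that $x\le i\in I$ implies $x\in I$, and $i,j\in I$ implies $i\vee j\in I$ (equivalently, an ideal of the associated Boolean ring). For a subset $I$ of $B=\{a_1,\dots,a_{2^n}\}$, its codeword is $c_I=(c_1,\dots,c_{2^n})\in\mathbb{Z}_2^{2^n}$ with $c_i=1$ if $a_i\in I$ and $c_i=0$ otherwise. A binary linear code of length $N$ is a subspace of $\mathbb{Z}_2^N$; its distance is the minimum Hamming weight of its nonzero vectors. -}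

module Defs where

open import Level using (Level)
open import Data.Nat using (ℕ; zero; suc; _+_; _^_; _≤_)
open import Data.Bool using (Bool; true; false; _xor_)
open import Data.Fin using (Fin) renaming (zero to fzero; suc to fsuc)
open import Data.Vec using (Vec; []; _∷_; lookup; replicate; zipWith) renaming (tabulate to tabulateV)
open import Data.Product using (Σ; ∃; _×_)
open import Relation.Binary.PropositionalEquality using (_≡_; _≢_)
open import Relation.Nullary using (¬_)
open import Function.Bundles using (_⇔_)
open import Algebra.Lattice.Bundles using (BooleanAlgebra)

module _ {c ℓ : Level} (B : BooleanAlgebra c ℓ) where
  open BooleanAlgebra B

  _≤B_ : Carrier → Carrier → Set ℓ
  x ≤B y = (x ∨ y) ≈ y

  record Enumeration (n : ℕ) : Set (c Level.⊔ ℓ) where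
    field
      a    : Fin (2 ^ n) → Carrier
      inj  : ∀ i j → a i ≈ a j → i ≡ j
      surj : ∀ x → ∃ λ i → a i ≈ x

  module _ {n : ℕ} (e : Enumeration n) where
    open Enumeration e

    -- A subset I of B is given (via the enumeration) by its characteristic
    -- vector: a_i ∈ I  iff  lookup I i ≡ true.
    SubsetB : Set
    SubsetB = Vec Bool (2 ^ n)

    _∈B_ : Fin (2 ^ n) → SubsetB → Set
    i ∈B I = lookup I i ≡ true

    record IsIdeal (I : SubsetB) : Set (c Level.⊔ ℓ) where
      field
        nonempty : ∃ λ i → i ∈B I
        downward : ∀ i j → a j ≤B a i → i ∈B I → j ∈B I
        joins    : ∀ i j k → i ∈B I → j ∈B I → a k ≈ (a i ∨ a j) → k ∈B I

    codeword : SubsetB → Vec Bool (2 ^ n)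
    codeword I = tabulateV (λ i → lookup I i)

Word : ℕ → Set
Word N = Vec Bool N

-- number of elements of a subset / Hamming weight of a word
weight : ∀ {N} → Word N → ℕ
weight []           = 0
weight (true  ∷ w)  = suc (weight w)
weight (false ∷ w)  = weight w

zeroW : ∀ {N} → Word N
zeroW = replicate _ false

_⊕_ : ∀ {N} → Word N → Word N → Word N
_⊕_ = zipWith _xor_

scale : ∀ {N} → Bool → Word N → Word N
scale true  w = w
scale false w = zeroW

lincomb : ∀ {k N} → (Fin k → Bool) → (Fin k → Word N) → Word N
lincomb {zero}  λs vs = zeroW
lincomb {suc k} λs vs = scale (λs fzero) (vs fzero) ⊕ lincomb (λ i → λs (fsuc i)) (λ i → vs (fsuc i))

Code : ℕ → Set₁
Code N = Word N → Set

Span : ∀ {k N} → (Fin k → Word N) → Code N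
Span vs w = ∃ λ (λs : Fin _ → Bool) → w ≡ lincomb λs vs

record IsLinearCode {N} (C : Code N) : Set where
  field
    has-zero : C zeroW
    closed+  : ∀ u v → C u → C v → C (u ⊕ v)

LinIndep : ∀ {k N} → (Fin k → Word N) → Set
LinIndep vs = ∀ λs → lincomb λs vs ≡ zeroW → ∀ i → λs i ≡ false

HasDimension : ∀ {N} → Code N → ℕ → Set
HasDimension {N} C k =
  Σ (Fin k → Word N) λ vs → LinIndep vs × (∀ w → C w ⇔ Span vs w)

HasMinDistance : ∀ {N} → Code N → ℕ → Set
HasMinDistance C d =
  (∃ λ w → C w × w ≢ zeroW × weight w ≡ d) ×
  (∀ w → C w → w ≢ zeroW → d ≤ weight w)

-- Let atom₁,…,atom_k be the atoms of B and let bitᵢ x say whether atomᵢ ⊑ x.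
-- The bits determine x, and every bit pattern is realised by a join of atoms,
-- so 2ᵏ = 2ⁿ and k = n. Toggling atomᵢ is an involution of B that moves every
-- element into or out of the ideal ↓∂atomᵢ, so that ideal has 2ⁿ⁻¹ elements.
-- Conversely an ideal J of that size misses 𝟙, hence by descent some atom p,
-- hence every element above p; so J ⊆ ↓∂p, and equal sizes force J = ↓∂p.
-- Finally, in a ℤ₂-combination of the codewords of the ↓∂atomⱼ with a nonzero
-- coefficient at i, toggling atomᵢ flips exactly the i-th summand and hence the
-- value of the combination; so every nonzero combination has weight 2ⁿ⁻¹,
-- which gives linear independence and the minimum distance at once.
module Submission where

open import Defs
open import Data.Nat using (ℕ; _*_; _^_; _∸_; _≤_)
open import Data.Fin using (Fin)
open import Data.Product using (Σ; ∃; _×_)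
open import Relation.Binary.PropositionalEquality using (_≡_)
open import Algebra.Lattice.Bundles using (BooleanAlgebra)

module Counting where

  open import Data.Bool using (Bool; true; false; not; if_then_else_)
  open import Data.Fin using (zero; suc)
  import Data.Fin.Permutation as Perm
  open import Data.Nat using (zero; suc; _+_; _<_; z≤n; s≤s)
  open import Data.Nat.Properties using (+-0-commutativeMonoid; +-identityʳ; +-suc; m≤n⇒m≤1+n; <⇒≢)
  open import Data.Vec using (Vec; []; _∷_; lookup)
  open import Data.Vec.Properties using (tabulate∘lookup; tabulate-cong)
  open import Data.Empty using (⊥-elim)
  open import Function using (_∘_)
  open import Relation.Binary.PropositionalEquality using (_≗_; refl; sym; trans; cong; module ≡-Reasoning)
  open import Algebra.Properties.CommutativeMonoid.Sum +-0-commutativeMonoid using (sum; sum-cong-≗; sum-permute)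

  count : ∀ {M} → (Fin M → Bool) → ℕ
  count g = sum (λ t → if g t then 1 else 0)

  _⊆_ : ∀ {M} (f g : Fin M → Bool) → Set
  f ⊆ g = ∀ t → f t ≡ true → g t ≡ true

  count-cong : ∀ {M} {f g : Fin M → Bool} → f ≗ g → count f ≡ count g
  count-cong f≗g = sum-cong-≗ (cong (λ b → if b then 1 else 0) ∘ f≗g)

  count-complement : ∀ {M} (g : Fin M → Bool) → count g + count (not ∘ g) ≡ M
  count-complement {zero}  g = refl
  count-complement {suc M} g with g zero
  ... | true  = cong suc (count-complement (g ∘ suc))
  ... | false = trans (+-suc (count (g ∘ suc)) _) (cong suc (count-complement (g ∘ suc)))

  count-all : ∀ {M} (g : Fin M → Bool) → (∀ t → g t ≡ true) → count g ≡ M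
  count-all {zero}  g all = refl
  count-all {suc M} g all rewrite all zero = cong suc (count-all (g ∘ suc) (all ∘ suc))

  count-involution : ∀ {M} (σ : Fin M → Fin M) → (∀ t → σ (σ t) ≡ t) →
                     (g : Fin M → Bool) → count (g ∘ σ) ≡ count g
  count-involution σ σσ g = sym (sum-permute _ (Perm.permutation σ σ σσ σσ))

  count-half : ∀ {M} (σ : Fin M → Fin M) → (∀ t → σ (σ t) ≡ t) →
               (g : Fin M → Bool) → (∀ t → g (σ t) ≡ not (g t)) → 2 * count g ≡ M
  count-half {M} σ σσ g flips = begin
    count g + (count g + 0)     ≡⟨ cong (count g +_) (+-identityʳ (count g)) ⟩
    count g + count g           ≡⟨ cong (count g +_) (count-involution σ σσ g) ⟨
    count g + count (g ∘ σ)     ≡⟨ cong (count g +_) (count-cong flips) ⟩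
    count g + count (not ∘ g)   ≡⟨ count-complement g ⟩
    M                           ∎
    where open ≡-Reasoning

  count-mono : ∀ {M} {f g : Fin M → Bool} → f ⊆ g → count f ≤ count g
  count-mono {zero}  f⊆g = z≤n
  count-mono {suc M} {f} {g} f⊆g with f zero in f₀ | g zero in g₀
  ... | true  | true  = s≤s (count-mono (f⊆g ∘ suc))
  ... | true  | false with () ← trans (sym (f⊆g zero f₀)) g₀
  ... | false | true  = m≤n⇒m≤1+n (count-mono (f⊆g ∘ suc))
  ... | false | false = count-mono (f⊆g ∘ suc)

  count-< : ∀ {M} {f g : Fin M → Bool} → f ⊆ g → ∀ t → f t ≡ false → g t ≡ true → count f < count g
  count-< {suc M} {f} {g} f⊆g zero ft gt rewrite ft | gt = s≤s (count-mono (f⊆g ∘ suc))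
  count-< {suc M} {f} {g} f⊆g (suc t) ft gt with f zero in f₀ | g zero in g₀
  ... | true  | true  = s≤s (count-< (f⊆g ∘ suc) t ft gt)
  ... | true  | false with () ← trans (sym (f⊆g zero f₀)) g₀
  ... | false | true  = m≤n⇒m≤1+n (count-< (f⊆g ∘ suc) t ft gt)
  ... | false | false = count-< (f⊆g ∘ suc) t ft gt

  count-⊆-≡ : ∀ {M} {f g : Fin M → Bool} → f ⊆ g → count f ≡ count g → f ≗ g
  count-⊆-≡ {f = f} {g} f⊆g eq t with f t in ft | g t in gt
  ... | true  | true  = refl
  ... | false | false = refl
  ... | true  | false with () ← trans (sym (f⊆g t ft)) gt
  ... | false | true  = ⊥-elim (<⇒≢ (count-< f⊆g t ft gt) eq)

  lookup-≗⇒≡ : ∀ {A : Set} {M} {v w : Vec A M} → lookup v ≗ lookup w → v ≡ w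
  lookup-≗⇒≡ {v = v} {w} v≗w = trans (sym (tabulate∘lookup v)) (trans (tabulate-cong v≗w) (tabulate∘lookup w))

  weight≡count : ∀ {M} (w : Vec Bool M) → weight w ≡ count (lookup w)
  weight≡count []          = refl
  weight≡count (true ∷ w)  = cong suc (weight≡count w)
  weight≡count (false ∷ w) = weight≡count w

  weight-all : ∀ {M} (w : Vec Bool M) → (∀ t → lookup w t ≡ true) → weight w ≡ M
  weight-all w all = trans (weight≡count w) (count-all (lookup w) all)

  weight-half : ∀ {M} (σ : Fin M → Fin M) → (∀ t → σ (σ t) ≡ t) →
                (w : Vec Bool M) → (∀ t → lookup w (σ t) ≡ not (lookup w t)) → 2 * weight w ≡ M
  weight-half σ σσ w flips = trans (cong (2 *_) (weight≡count w)) (count-half σ σσ (lookup w) flips)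

  weight-⊆-≡ : ∀ {M} {v w : Vec Bool M} → lookup v ⊆ lookup w → weight v ≡ weight w → v ≡ w
  weight-⊆-≡ {v = v} {w} v⊆w eq =
    lookup-≗⇒≡ (count-⊆-≡ v⊆w (trans (sym (weight≡count v)) (trans eq (weight≡count w))))

open Counting

module BinaryLinearCodes where

  open import Algebra.Bundles using (Monoid; CommutativeRing)
  import Algebra.Properties.Monoid.Sum as MonoidSum
  import Algebra.Properties.CommutativeMonoid.Sum as CommutativeMonoidSum
  open import Data.Bool using (Bool; true; false; _∧_; _xor_)
  import Data.Bool as Bool
  open import Data.Bool.Properties using (xor-∧-commutativeRing; ∧-distribˡ-xor; ∧-distribʳ-xor; ¬-not)
  open import Data.Empty using (⊥-elim)
  open import Data.Fin using (zero; suc; _≟_)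
  open import Data.Fin.Properties using (suc-injective; any?)
  open import Data.Nat using (zero; suc; _<_)
  open import Data.Nat.Properties using (≤-reflexive; <⇒≢)
  open import Data.Product using (_,_)
  open import Data.Vec using (lookup)
  open import Data.Vec.Properties using (lookup-zipWith; lookup-replicate)
  open import Data.Vec.Functional using (Vector)
  open import Function using (_∘_)
  open import Relation.Binary.PropositionalEquality using (_≢_; refl; sym; trans; cong; cong₂; module ≡-Reasoning)
  open import Relation.Nullary using (yes; no; does)
  open import Relation.Nullary.Decidable using (dec-true)

  module _ {a ℓ} (M : Monoid a ℓ) where
    open Monoid M using (Carrier; _≈_; _∙_; ε; ∙-congˡ; ∙-congʳ; identityˡ; identityʳ; setoid)
    open MonoidSum M using (sum; sum-cong-≋; sum-replicate-zero)
    open import Relation.Binary.Reasoning.Setoid setoid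

    sum-select : ∀ {n} (f : Vector Carrier n) i → (∀ j → j ≢ i → f j ≈ ε) → sum f ≈ f i
    sum-select {suc n} f zero others = begin
      f zero ∙ sum (f ∘ suc)       ≈⟨ ∙-congˡ (sum-cong-≋ λ j → others (suc j) λ ()) ⟩
      f zero ∙ sum {n} (λ _ → ε)   ≈⟨ ∙-congˡ (sum-replicate-zero n) ⟩
      f zero ∙ ε                   ≈⟨ identityʳ (f zero) ⟩
      f zero                       ∎
    sum-select f (suc i) others = begin
      f zero ∙ sum (f ∘ suc)       ≈⟨ ∙-congʳ (others zero λ ()) ⟩
      ε ∙ sum (f ∘ suc)            ≈⟨ identityˡ _ ⟩
      sum (f ∘ suc)                ≈⟨ sum-select (f ∘ suc) i (λ j → others (suc j) ∘ (_∘ suc-injective)) ⟩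
      f (suc i)                    ∎

  ℤ₂-monoid : Monoid _ _
  ℤ₂-monoid = CommutativeRing.+-monoid xor-∧-commutativeRing

  module ℤ₂ = CommutativeMonoidSum (CommutativeRing.+-commutativeMonoid xor-∧-commutativeRing)
  open ℤ₂ using (sum; sum-cong-≗; ∑-distrib-+; sum-replicate-zero)

  weight-zeroW : ∀ {N} → weight (zeroW {N}) ≡ 0
  weight-zeroW {zero}  = refl
  weight-zeroW {suc N} = weight-zeroW {N}

  lookup-scale : ∀ {N} b (w : Word N) t → lookup (scale b w) t ≡ b ∧ lookup w t
  lookup-scale true  w t = refl
  lookup-scale false w t = lookup-replicate t false

  lookup-lincomb : ∀ {k N} (ls : Fin k → Bool) (vs : Fin k → Word N) t →
                   lookup (lincomb ls vs) t ≡ sum (λ j → ls j ∧ lookup (vs j) t)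
  lookup-lincomb {zero}  ls vs t = lookup-replicate t false
  lookup-lincomb {suc k} ls vs t =
    trans (lookup-zipWith _xor_ t (scale (ls zero) (vs zero)) (lincomb (ls ∘ suc) (vs ∘ suc)))
          (cong₂ _xor_ (lookup-scale (ls zero) (vs zero) t) (lookup-lincomb (ls ∘ suc) (vs ∘ suc) t))

  lincomb-zero : ∀ {k N} (ls : Fin k → Bool) (vs : Fin k → Word N) →
                 (∀ j → ls j ≡ false) → lincomb ls vs ≡ zeroW
  lincomb-zero {k} ls vs none = lookup-≗⇒≡ λ t → begin
    lookup (lincomb ls vs) t             ≡⟨ lookup-lincomb ls vs t ⟩
    sum (λ j → ls j ∧ lookup (vs j) t)   ≡⟨ sum-cong-≗ (λ j → cong (_∧ _) (none j)) ⟩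
    sum {k} (λ _ → false)                ≡⟨ sum-replicate-zero k ⟩
    false                                ≡⟨ lookup-replicate t false ⟨
    lookup zeroW t                       ∎
    where open ≡-Reasoning

  lincomb-⊕ : ∀ {k N} (ls ms : Fin k → Bool) (vs : Fin k → Word N) →
              lincomb ls vs ⊕ lincomb ms vs ≡ lincomb (λ j → ls j xor ms j) vs
  lincomb-⊕ ls ms vs = lookup-≗⇒≡ λ t → begin
    lookup (lincomb ls vs ⊕ lincomb ms vs) t
      ≡⟨ lookup-zipWith _xor_ t (lincomb ls vs) (lincomb ms vs) ⟩
    lookup (lincomb ls vs) t xor lookup (lincomb ms vs) t
      ≡⟨ cong₂ _xor_ (lookup-lincomb ls vs t) (lookup-lincomb ms vs t) ⟩
    sum (λ j → ls j ∧ lookup (vs j) t) xor sum (λ j → ms j ∧ lookup (vs j) t)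
      ≡⟨ ∑-distrib-+ (λ j → ls j ∧ lookup (vs j) t) (λ j → ms j ∧ lookup (vs j) t) ⟨
    sum (λ j → (ls j ∧ lookup (vs j) t) xor (ms j ∧ lookup (vs j) t))
      ≡⟨ sum-cong-≗ (λ j → ∧-distribʳ-xor (lookup (vs j) t) (ls j) (ms j)) ⟨
    sum (λ j → (ls j xor ms j) ∧ lookup (vs j) t)
      ≡⟨ lookup-lincomb _ vs t ⟨
    lookup (lincomb (λ j → ls j xor ms j) vs) t ∎
    where open ≡-Reasoning

  Span-isLinearCode : ∀ {k N} (vs : Fin k → Word N) → IsLinearCode (Span vs)
  Span-isLinearCode vs = record
    { has-zero = (λ _ → false) , sym (lincomb-zero _ vs λ _ → refl)
    ; closed+  = λ { _ _ (ls , refl) (ms , refl) → (λ j → ls j xor ms j) , lincomb-⊕ ls ms vs }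
    }

  lookup-lincomb-shift : ∀ {k N} (ls : Fin k → Bool) (vs : Fin k → Word N) (δ : Fin k → Bool) s t →
    (∀ j → lookup (vs j) s ≡ lookup (vs j) t xor δ j) →
    lookup (lincomb ls vs) s ≡ lookup (lincomb ls vs) t xor sum (λ j → ls j ∧ δ j)
  lookup-lincomb-shift ls vs δ s t shift = begin
    lookup (lincomb ls vs) s
      ≡⟨ lookup-lincomb ls vs s ⟩
    sum (λ j → ls j ∧ lookup (vs j) s)
      ≡⟨ sum-cong-≗ (λ j → cong (ls j ∧_) (shift j)) ⟩
    sum (λ j → ls j ∧ (lookup (vs j) t xor δ j))
      ≡⟨ sum-cong-≗ (λ j → ∧-distribˡ-xor (ls j) _ (δ j)) ⟩
    sum (λ j → (ls j ∧ lookup (vs j) t) xor (ls j ∧ δ j))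
      ≡⟨ ∑-distrib-+ (λ j → ls j ∧ lookup (vs j) t) (λ j → ls j ∧ δ j) ⟩
    sum (λ j → ls j ∧ lookup (vs j) t) xor sum (λ j → ls j ∧ δ j)
      ≡⟨ cong (_xor _) (lookup-lincomb ls vs t) ⟨
    lookup (lincomb ls vs) t xor sum (λ j → ls j ∧ δ j) ∎
    where open ≡-Reasoning

  module ConstantWeight {k N d} (vs : Fin k → Word N) (d>0 : 0 < d)
    (weight-lincomb : ∀ ls i → ls i ≡ true → weight (lincomb ls vs) ≡ d) where

    linIndep : LinIndep vs
    linIndep ls ls·vs≡0 i with ls i in lsᵢ
    ... | false = refl
    ... | true  = ⊥-elim (<⇒≢ d>0 (begin
      0                        ≡⟨ weight-zeroW {N} ⟨
      weight (zeroW {N})       ≡⟨ cong weight ls·vs≡0 ⟨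
      weight (lincomb ls vs)   ≡⟨ weight-lincomb ls i lsᵢ ⟩
      d                        ∎))
      where open ≡-Reasoning

    hasMinDistance : Fin k → HasMinDistance (Span vs) d
    hasMinDistance i₀ = (lincomb δ vs , (δ , refl) , nonzero , weight-lincomb δ i₀ δᵢ₀) , lower-bound
      where
      δ : Fin k → Bool
      δ j = does (j ≟ i₀)
      δᵢ₀ : δ i₀ ≡ true
      δᵢ₀ = dec-true (i₀ ≟ i₀) refl
      nonzero : lincomb δ vs ≢ zeroW
      nonzero δ·vs≡0 with () ← trans (sym δᵢ₀) (linIndep δ δ·vs≡0 i₀)
      lower-bound : ∀ w → Span vs w → w ≢ zeroW → d ≤ weight w
      lower-bound w (ls , refl) w≢0 with any? (λ j → ls j Bool.≟ true)
      ... | yes (i , lsᵢ) = ≤-reflexive (sym (weight-lincomb ls i lsᵢ))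
      ... | no none       = ⊥-elim (w≢0 (lincomb-zero ls vs λ j → ¬-not λ lsⱼ → none (j , lsⱼ)))

open BinaryLinearCodes

module FiniteBooleanAlgebras where

  open import Level using (Level; _⊔_)
  import Algebra.Lattice.Properties.Lattice as LatticeProperties
  import Algebra.Lattice.Properties.BooleanAlgebra as BooleanAlgebraProperties
  import Relation.Binary.Lattice.Bundles as OrderLattice
  open import Data.Bool using (Bool; true; false; not; if_then_else_; _xor_)
  import Data.Bool as Bool
  import Data.Bool.Properties as BoolProperties
  open import Data.Bool.Properties
    using (¬-not; not-¬; not-injective; not-distribˡ-xor; xor-assoc; xor-same; xor-identityʳ; xor-comm)
  open import Data.Empty using (⊥-elim)
  open import Data.Fin using (zero; suc; _≟_; cast; fromℕ<; funToFin; finToFun; combine)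
  open import Data.Fin.Properties
    using (cast-involutive; all?; any?; 2↔Bool; finToFun-funToFin; funToFin-finToFin; injective⇒≤)
  open import Data.List using (List; _∷_; length; filter; allFin)
  import Data.List as List
  import Data.List.Relation.Unary.All as All
  open import Data.List.Relation.Unary.Any using (index)
  open import Data.List.Relation.Unary.Any.Properties using (lookup-index)
  import Data.List.Relation.Unary.AllPairs as AllPairs
  open import Data.List.Relation.Unary.Unique.Propositional using (Unique)
  open import Data.List.Relation.Unary.Unique.Propositional.Properties using (allFin⁺; filter⁺)
  open import Data.List.Membership.Propositional using (_∈_)
  open import Data.List.Membership.Propositional.Properties using (∈-lookup; ∈-filter⁺; ∈-filter⁻; ∈-allFin)
  open import Data.Nat using (zero; suc; _<_; z≤n; s≤s)
  open import Data.Nat.Induction using (<-wellFounded)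
  import Data.Nat.Properties as ℕ
  open import Data.Product using (_,_; proj₁; proj₂)
  open import Data.Sum using (_⊎_; inj₁; inj₂)
  import Data.Sum as Sum
  open import Data.Vec using (lookup; tabulate)
  open import Data.Vec.Properties using (lookup∘tabulate)
  open import Function using (_∘_; id)
  open import Function.Bundles using (mk⇔; Inverse)
  open import Induction.WellFounded using (module All)
  import Relation.Binary.Construct.On as On
  import Relation.Binary.Reasoning.Setoid as SetoidReasoning
  open import Relation.Binary.PropositionalEquality as ≡ using (_≢_; _≗_; cong)
  open import Relation.Nullary using (¬_; Dec; yes; no; does; ¬?; contradiction)
  open import Relation.Nullary.Decidable
    using (decidable-stable; map′; _×-dec_; _⊎-dec_; _→-dec_; dec-true; dec-false; does-⇔)

  dec-true⁻¹ : ∀ {p} {A : Set p} (a? : Dec A) → does a? ≡ true → A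
  dec-true⁻¹ (yes a) _ = a

  Unique-lookup-injective : ∀ {A : Set} {xs : List A} → Unique xs →
                            ∀ i j → List.lookup xs i ≡ List.lookup xs j → i ≡ j
  Unique-lookup-injective {xs = _ ∷ _} _                      zero    zero    _  = ≡.refl
  Unique-lookup-injective {xs = _ ∷ _} (x∉xs AllPairs.∷ _)    zero    (suc j) eq =
    contradiction eq (All.lookup x∉xs (∈-lookup j))
  Unique-lookup-injective {xs = _ ∷ _} (x∉xs AllPairs.∷ _)    (suc i) zero    eq =
    contradiction (≡.sym eq) (All.lookup x∉xs (∈-lookup i))
  Unique-lookup-injective {xs = _ ∷ _} (_ AllPairs.∷ unique) (suc i) (suc j) eq =
    cong suc (Unique-lookup-injective unique i j eq)

  funToFin-cong : ∀ {m n} {f g : Fin m → Fin n} → f ≗ g → funToFin f ≡ funToFin g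
  funToFin-cong {zero}  f≗g = ≡.refl
  funToFin-cong {suc m} f≗g = ≡.cong₂ combine (f≗g zero) (funToFin-cong (f≗g ∘ suc))

  module _ {k : ℕ} where
    open Inverse 2↔Bool using (to; from; strictlyInverseˡ; strictlyInverseʳ)

    toCode : (Fin k → Bool) → Fin (2 ^ k)
    toCode v = funToFin (from ∘ v)

    fromCode : Fin (2 ^ k) → Fin k → Bool
    fromCode u = to ∘ finToFun u

    fromCode-toCode : ∀ v → fromCode (toCode v) ≗ v
    fromCode-toCode v i = ≡.trans (cong to (finToFun-funToFin (from ∘ v) i)) (strictlyInverseˡ (v i))

    toCode-fromCode : ∀ u → toCode (fromCode u) ≡ u
    toCode-fromCode u = ≡.trans (funToFin-cong {k} {2} (strictlyInverseʳ ∘ finToFun u)) (funToFin-finToFin {k} {2} u)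

    toCode-cong : ∀ {v w} → v ≗ w → toCode v ≡ toCode w
    toCode-cong v≗w = funToFin-cong (cong from ∘ v≗w)

  2*2^[n∸1]≡2^n : ∀ {n} → 1 ≤ n → 2 * 2 ^ (n ∸ 1) ≡ 2 ^ n
  2*2^[n∸1]≡2^n {suc n} _ = ≡.refl

  2^-reflects-≤ : ∀ {m n} → 2 ^ m ≤ 2 ^ n → m ≤ n
  2^-reflects-≤ 2^m≤2^n = ℕ.≮⇒≥ λ n<m → ℕ.<⇒≱ (ℕ.^-monoʳ-< 2 (s≤s (s≤s z≤n)) n<m) 2^m≤2^n

  module FiniteBooleanAlgebra {c ℓ : Level} (B : BooleanAlgebra c ℓ) {n : ℕ} (e : Enumeration B n) where
    open BooleanAlgebra B renaming (¬_ to ∂_; ⊥ to 𝟘; ⊤ to 𝟙)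
    open BooleanAlgebraProperties B using (¬-involutive; ∧-zeroˡ; ∧-zeroʳ; ∧-identityʳ; ∨-identityʳ; deMorgan₂)
    open LatticeProperties lattice using (∨-∧-orderTheoreticLattice)
    open OrderLattice.Lattice ∨-∧-orderTheoreticLattice
      using (∨-least; ∧-greatest)
      renaming ( _≤_ to _⊑_; x≤x∨y to x⊑x∨y; y≤x∨y to y⊑x∨y; x∧y≤x to x∧y⊑x; x∧y≤y to x∧y⊑y
               ; ≤-respˡ-≈ to ⊑-respˡ-≈; ≤-respʳ-≈ to ⊑-respʳ-≈
               ; refl to ⊑-refl; trans to ⊑-trans; antisym to ⊑-antisym)
    open Enumeration e

    N : ℕ
    N = 2 ^ n

    ≤B⇒⊑ : ∀ {x y} → _≤B_ B x y → x ⊑ y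
    ≤B⇒⊑ {x} x∨y≈y = ⊑-respʳ-≈ x∨y≈y (x⊑x∨y x _)

    ⊑⇒≤B : ∀ {x y} → x ⊑ y → _≤B_ B x y
    ⊑⇒≤B {x} {y} x⊑y = ⊑-antisym (∨-least x⊑y ⊑-refl) (y⊑x∨y x y)

    𝟘⊑ : ∀ x → 𝟘 ⊑ x
    𝟘⊑ x = sym (∧-zeroˡ x)

    ⊑𝟙 : ∀ x → x ⊑ 𝟙
    ⊑𝟙 x = sym (∧-identityʳ x)

    ⊑𝟘 : ∀ {x} → x ⊑ 𝟘 → x ≈ 𝟘
    ⊑𝟘 {x} x≈x∧𝟘 = trans x≈x∧𝟘 (∧-zeroʳ x)

    ⊑-∂-disjoint : ∀ {p x} → p ⊑ x → p ⊑ ∂ x → p ≈ 𝟘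
    ⊑-∂-disjoint {x = x} p⊑x p⊑∂x = ⊑𝟘 (⊑-respʳ-≈ (∧-complementʳ x) (∧-greatest p⊑x p⊑∂x))

    ∧∂≈𝟘⇒⊑ : ∀ {x y} → x ∧ ∂ y ≈ 𝟘 → x ⊑ y
    ∧∂≈𝟘⇒⊑ {x} {y} x∧∂y≈𝟘 = begin
      x                         ≈⟨ ∧-identityʳ x ⟨
      x ∧ 𝟙                     ≈⟨ ∧-congˡ (∨-complementʳ y) ⟨
      x ∧ (y ∨ ∂ y)             ≈⟨ ∧-distribˡ-∨ x y (∂ y) ⟩
      (x ∧ y) ∨ (x ∧ ∂ y)       ≈⟨ ∨-congˡ x∧∂y≈𝟘 ⟩
      (x ∧ y) ∨ 𝟘               ≈⟨ ∨-identityʳ (x ∧ y) ⟩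
      x ∧ y                     ∎
      where open SetoidReasoning setoid

    idx : Carrier → Fin N
    idx x = proj₁ (surj x)

    a-idx : ∀ x → a (idx x) ≈ x
    a-idx x = proj₂ (surj x)

    idx-resp : ∀ {x y} → x ≈ y → idx x ≡ idx y
    idx-resp {x} {y} x≈y = inj _ _ (trans (a-idx x) (trans x≈y (sym (a-idx y))))

    _≈?_ : ∀ x y → Dec (x ≈ y)
    x ≈? y = map′ (λ eq → trans (sym (a-idx x)) (trans (reflexive (cong a eq)) (a-idx y))) idx-resp
                  (idx x ≟ idx y)

    _⊑?_ : ∀ x y → Dec (x ⊑ y)
    x ⊑? y = x ≈? (x ∧ y)

    IsAtom : Carrier → Set (c ⊔ ℓ)
    IsAtom p = ¬ p ≈ 𝟘 × (∀ x → x ⊑ p → x ≈ 𝟘 ⊎ x ≈ p)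

    atom? : ∀ p → Dec (IsAtom p)
    atom? p = map′ fromEnumerated toEnumerated
      (¬? (p ≈? 𝟘) ×-dec all? (λ t → a t ⊑? p →-dec (a t ≈? 𝟘 ⊎-dec a t ≈? p)))
      where
      fromEnumerated : ¬ p ≈ 𝟘 × (∀ t → a t ⊑ p → a t ≈ 𝟘 ⊎ a t ≈ p) → IsAtom p
      fromEnumerated (p≉𝟘 , below) = p≉𝟘 , λ x x⊑p →
        Sum.map (trans (sym (a-idx x))) (trans (sym (a-idx x))) (below (idx x) (⊑-respˡ-≈ (sym (a-idx x)) x⊑p))
      toEnumerated : IsAtom p → ¬ p ≈ 𝟘 × (∀ t → a t ⊑ p → a t ≈ 𝟘 ⊎ a t ≈ p)
      toEnumerated (p≉𝟘 , below) = p≉𝟘 , λ t → below (a t)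

    atom-resp : ∀ {p q} → p ≈ q → IsAtom p → IsAtom q
    atom-resp p≈q (p≉𝟘 , below) =
      (λ q≈𝟘 → p≉𝟘 (trans p≈q q≈𝟘)) ,
      λ x x⊑q → Sum.map₂ (λ x≈p → trans x≈p p≈q) (below x (⊑-respʳ-≈ (sym p≈q) x⊑q))

    atom-split : ∀ {p} → IsAtom p → ∀ x → p ⊑ x ⊎ p ⊑ ∂ x
    atom-split {p} (_ , below) x with below (p ∧ x) (x∧y⊑x p x)
    ... | inj₂ p∧x≈p = inj₁ (sym p∧x≈p)
    ... | inj₁ p∧x≈𝟘 = inj₂ (∧∂≈𝟘⇒⊑ (trans (∧-congˡ (¬-involutive x)) p∧x≈𝟘))

    -- Descent: unless x is an atom, x = y ∨ (x ∧ ∂ y) for some 𝟘 < y < x, and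
    -- Q passes to one of the two strictly smaller parts.
    module _ {q} {Q : Carrier → Set q} (Q-resp : ∀ {x y} → x ≈ y → Q x → Q y) (¬Q𝟘 : ¬ Q 𝟘)
             (Q-join : ∀ y z → Q (y ∨ z) → Q y ⊎ Q z) where

      down-count : Carrier → ℕ
      down-count x = count (λ t → does (a t ⊑? x))

      down-count-< : ∀ {x y} → y ⊑ x → ¬ y ≈ x → down-count y < down-count x
      down-count-< {x} {y} y⊑x y≉x = ℕ.≤∧≢⇒< (count-mono below) λ same → y≉x (⊑-antisym y⊑x (x⊑y same))
        where
        below : (λ t → does (a t ⊑? y)) ⊆ (λ t → does (a t ⊑? x))
        below t t⊑y = dec-true (a t ⊑? x) (⊑-trans (dec-true⁻¹ (a t ⊑? y) t⊑y) y⊑x)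
        x⊑y : down-count y ≡ down-count x → x ⊑ y
        x⊑y same = ⊑-respˡ-≈ (a-idx x) (dec-true⁻¹ (a (idx x) ⊑? y) (≡.trans (count-⊆-≡ below same (idx x))
          (dec-true (a (idx x) ⊑? x) (⊑-respˡ-≈ (sym (a-idx x)) ⊑-refl))))

      AtomBelow : Carrier → Set _
      AtomBelow x = ∃ λ p → IsAtom p × p ⊑ x × Q p

      weaken : ∀ {x y} → y ⊑ x → AtomBelow y → AtomBelow x
      weaken y⊑x (p , p-atom , p⊑y , Qp) = p , p-atom , ⊑-trans p⊑y y⊑x , Qp

      atom-below : ∀ x → Q x → AtomBelow x
      atom-below = All.wfRec (On.wellFounded down-count <-wellFounded) _ _ descend
        where
        descend : ∀ x → (∀ {y} → down-count y < down-count x → Q y → AtomBelow y) → Q x → AtomBelow x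
        descend x rec Qx with any? (λ t → a t ⊑? x ×-dec ¬? (a t ≈? 𝟘) ×-dec ¬? (a t ≈? x))
        ... | no ¬between = x , ((λ x≈𝟘 → ¬Q𝟘 (Q-resp x≈𝟘 Qx)) , atomic) , ⊑-refl , Qx
          where
          atomic : ∀ y → y ⊑ x → y ≈ 𝟘 ⊎ y ≈ x
          atomic y y⊑x with y ≈? 𝟘 | y ≈? x
          ... | yes y≈𝟘 | _       = inj₁ y≈𝟘
          ... | no _    | yes y≈x = inj₂ y≈x
          ... | no y≉𝟘  | no y≉x  = ⊥-elim (¬between (idx y , ⊑-respˡ-≈ (sym (a-idx y)) y⊑x ,
                                        y≉𝟘 ∘ trans (sym (a-idx y)) , y≉x ∘ trans (sym (a-idx y))))
        ... | yes (t , y⊑x , y≉𝟘 , y≉x) with Q-join y (x ∧ ∂ y) (Q-resp (sym split) Qx)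
          where
          y : Carrier
          y = a t
          split : y ∨ (x ∧ ∂ y) ≈ x
          split = begin
            y ∨ (x ∧ ∂ y)         ≈⟨ ∨-distribˡ-∧ y x (∂ y) ⟩
            (y ∨ x) ∧ (y ∨ ∂ y)   ≈⟨ ∧-cong (⊑⇒≤B y⊑x) (∨-complementʳ y) ⟩
            x ∧ 𝟙                 ≈⟨ ∧-identityʳ x ⟩
            x                     ∎
            where open SetoidReasoning setoid
        ... | inj₁ Qy = weaken y⊑x (rec (down-count-< y⊑x y≉x) Qy)
        ... | inj₂ Qz = weaken (x∧y⊑x x (∂ a t)) (rec (down-count-< (x∧y⊑x x (∂ a t)) z≉x) Qz)
          where
          z≉x : ¬ x ∧ ∂ a t ≈ x
          z≉x z≈x = y≉𝟘 (⊑-∂-disjoint ⊑-refl (⊑-trans y⊑x (⊑-respˡ-≈ z≈x (x∧y⊑y x (∂ a t)))))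

    atomList : List (Fin N)
    atomList = filter (atom? ∘ a) (allFin N)

    k : ℕ
    k = length atomList

    atom : Fin k → Carrier
    atom i = a (List.lookup atomList i)

    atom-isAtom : ∀ i → IsAtom (atom i)
    atom-isAtom i = proj₂ (∈-filter⁻ (atom? ∘ a) {xs = allFin N} (∈-lookup i))

    atom-injective : ∀ i j → atom i ≈ atom j → i ≡ j
    atom-injective i j eq = Unique-lookup-injective (filter⁺ (atom? ∘ a) (allFin⁺ N)) i j (inj _ _ eq)

    atom-index : ∀ {p} → IsAtom p → ∃ λ i → atom i ≈ p
    atom-index {p} p-atom = index p∈atoms , trans (reflexive (cong a (≡.sym (lookup-index p∈atoms)))) (a-idx p)
      where
      p∈atoms : idx p ∈ atomList
      p∈atoms = ∈-filter⁺ (atom? ∘ a) (∈-allFin (idx p)) (atom-resp (sym (a-idx p)) p-atom)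

    atom⊑atom⇒≡ : ∀ i j → atom i ⊑ atom j → i ≡ j
    atom⊑atom⇒≡ i j i⊑j with proj₂ (atom-isAtom j) (atom i) i⊑j
    ... | inj₁ i≈𝟘 = contradiction i≈𝟘 (proj₁ (atom-isAtom i))
    ... | inj₂ i≈j = atom-injective i j i≈j

    nonzero-atom-below : ∀ x → ¬ x ≈ 𝟘 → ∃ λ i → atom i ⊑ x
    nonzero-atom-below x x≉𝟘
      with atom-below (λ x≈y x≉𝟘 y≈𝟘 → x≉𝟘 (trans x≈y y≈𝟘)) (λ 𝟘≉𝟘 → 𝟘≉𝟘 refl) nonzero-join x x≉𝟘
      where
      nonzero-join : ∀ y z → ¬ y ∨ z ≈ 𝟘 → ¬ y ≈ 𝟘 ⊎ ¬ z ≈ 𝟘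
      nonzero-join y z y∨z≉𝟘 with y ≈? 𝟘 | z ≈? 𝟘
      ... | no y≉𝟘  | _        = inj₁ y≉𝟘
      ... | yes _   | no z≉𝟘   = inj₂ z≉𝟘
      ... | yes y≈𝟘 | yes z≈𝟘  = ⊥-elim (y∨z≉𝟘 (trans (∨-cong y≈𝟘 z≈𝟘) (∨-identityʳ 𝟘)))
    ... | p , p-atom , p⊑x , _ = proj₁ (atom-index p-atom) , ⊑-respˡ-≈ (sym (proj₂ (atom-index p-atom))) p⊑x

    bit : Fin k → Carrier → Bool
    bit i x = does (atom i ⊑? x)

    bit-resp : ∀ i {x y} → x ≈ y → bit i x ≡ bit i y
    bit-resp i x≈y = does-⇔ (mk⇔ (⊑-respʳ-≈ x≈y) (⊑-respʳ-≈ (sym x≈y))) (atom i ⊑? _) (atom i ⊑? _)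

    bit-𝟘 : ∀ i → bit i 𝟘 ≡ false
    bit-𝟘 i = dec-false (atom i ⊑? 𝟘) (proj₁ (atom-isAtom i) ∘ ⊑𝟘)

    bit-∨ : ∀ i x y → bit i (x ∨ y) ≡ bit i x Bool.∨ bit i y
    bit-∨ i x y = does-⇔ (mk⇔ split join) (atom i ⊑? (x ∨ y)) (atom i ⊑? x ⊎-dec atom i ⊑? y)
      where
      join : atom i ⊑ x ⊎ atom i ⊑ y → atom i ⊑ x ∨ y
      join = Sum.[ (λ i⊑x → ⊑-trans i⊑x (x⊑x∨y x y)) , (λ i⊑y → ⊑-trans i⊑y (y⊑x∨y x y)) ]
      split : atom i ⊑ x ∨ y → atom i ⊑ x ⊎ atom i ⊑ y
      split i⊑x∨y with atom-split (atom-isAtom i) x | atom-split (atom-isAtom i) y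
      ... | inj₁ i⊑x  | _         = inj₁ i⊑x
      ... | inj₂ _    | inj₁ i⊑y  = inj₂ i⊑y
      ... | inj₂ i⊑∂x | inj₂ i⊑∂y = contradiction
        (⊑-∂-disjoint i⊑x∨y (⊑-respʳ-≈ (sym (deMorgan₂ x y)) (∧-greatest i⊑∂x i⊑∂y))) (proj₁ (atom-isAtom i))

    bit-atom : ∀ i j → bit i (atom j) ≡ does (i ≟ j)
    bit-atom i j = does-⇔ (mk⇔ (atom⊑atom⇒≡ i j) λ { ≡.refl → ⊑-refl }) (atom i ⊑? atom j) (i ≟ j)

    bits-⊑ : ∀ x y → (∀ i → bit i x ≡ true → bit i y ≡ true) → x ⊑ y
    bits-⊑ x y below = ∧∂≈𝟘⇒⊑ (decidable-stable ((x ∧ ∂ y) ≈? 𝟘) λ x∧∂y≉𝟘 →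
      let i , i⊑x∧∂y = nonzero-atom-below (x ∧ ∂ y) x∧∂y≉𝟘
          i⊑x = ⊑-trans i⊑x∧∂y (x∧y⊑x x (∂ y))
          i⊑y = dec-true⁻¹ (atom i ⊑? y) (below i (dec-true (atom i ⊑? x) i⊑x))
      in proj₁ (atom-isAtom i) (⊑-∂-disjoint i⊑y (⊑-trans i⊑x∧∂y (x∧y⊑y x (∂ y)))))

    bits-injective : ∀ x y → (∀ i → bit i x ≡ bit i y) → x ≈ y
    bits-injective x y same =
      ⊑-antisym (bits-⊑ x y λ i → ≡.trans (≡.sym (same i))) (bits-⊑ y x λ i → ≡.trans (same i))

    ⋁ : ∀ {m} → (Fin m → Carrier) → Carrier
    ⋁ {zero}  g = 𝟘
    ⋁ {suc m} g = g zero ∨ ⋁ (g ∘ suc)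

    ⊑-⋁ : ∀ {m} (g : Fin m → Carrier) j → g j ⊑ ⋁ g
    ⊑-⋁ g zero    = x⊑x∨y (g zero) _
    ⊑-⋁ g (suc j) = ⊑-trans (⊑-⋁ (g ∘ suc) j) (y⊑x∨y (g zero) _)

    bit-⋁ : ∀ i {m} (g : Fin m → Carrier) → (∀ j → bit i (g j) ≡ false) → bit i (⋁ g) ≡ false
    bit-⋁ i {zero}  g none = bit-𝟘 i
    bit-⋁ i {suc m} g none =
      ≡.trans (bit-∨ i (g zero) _) (≡.cong₂ Bool._∨_ (none zero) (bit-⋁ i (g ∘ suc) (none ∘ suc)))

    realise : (Fin k → Bool) → Carrier
    realise v = ⋁ (λ j → if v j then atom j else 𝟘)

    bit-realise : ∀ v i → bit i (realise v) ≡ v i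
    bit-realise v i with v i in vᵢ
    ... | true  =
      dec-true (atom i ⊑? realise v) (⊑-respˡ-≈ (reflexive (cong (if_then atom i else 𝟘) vᵢ)) (⊑-⋁ _ i))
    ... | false = bit-⋁ i _ term
      where
      term : ∀ j → bit i (if v j then atom j else 𝟘) ≡ false
      term j with v j in vⱼ
      ... | false = bit-𝟘 i
      ... | true  = ≡.trans (bit-atom i j) (dec-false (i ≟ j) λ { ≡.refl → not-¬ vⱼ vᵢ })

    atoms-count : k ≡ n
    atoms-count =
      ℕ.≤-antisym (2^-reflects-≤ (injective⇒≤ decode-injective)) (2^-reflects-≤ (injective⇒≤ encode-injective))
      where
      encode : Fin N → Fin (2 ^ k)
      encode t = toCode (λ i → bit i (a t))
      encode-injective : ∀ {t u} → encode t ≡ encode u → t ≡ u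
      encode-injective {t} {u} eq = inj t u (bits-injective (a t) (a u) λ i →
        ≡.trans (≡.sym (fromCode-toCode _ i)) (≡.trans (cong (λ c → fromCode c i) eq) (fromCode-toCode _ i)))
      decode : Fin (2 ^ k) → Fin N
      decode c = idx (realise (fromCode c))
      decode-injective : ∀ {c d} → decode c ≡ decode d → c ≡ d
      decode-injective {c} {d} eq =
        ≡.trans (≡.sym (toCode-fromCode {k} c)) (≡.trans (toCode-cong {k} same) (toCode-fromCode {k} d))
        where
        realise≈ : realise (fromCode c) ≈ realise (fromCode d)
        realise≈ = trans (sym (a-idx _)) (trans (reflexive (cong a eq)) (a-idx _))
        same : fromCode c ≗ fromCode d
        same i = ≡.trans (≡.sym (bit-realise _ i)) (≡.trans (bit-resp i realise≈) (bit-realise _ i))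

    toggle : Fin k → Fin N → Fin N
    toggle p t = idx (realise (λ i → bit i (a t) xor does (i ≟ p)))

    bit-toggle : ∀ p t i → bit i (a (toggle p t)) ≡ bit i (a t) xor does (i ≟ p)
    bit-toggle p t i = ≡.trans (bit-resp i (a-idx _)) (bit-realise _ i)

    toggle-involutive : ∀ p t → toggle p (toggle p t) ≡ t
    toggle-involutive p t = inj _ _ (bits-injective _ _ λ i → begin
      bit i (a (toggle p (toggle p t)))   ≡⟨ bit-toggle p (toggle p t) i ⟩
      bit i (a (toggle p t)) xor δ i      ≡⟨ cong (_xor δ i) (bit-toggle p t i) ⟩
      (bit i (a t) xor δ i) xor δ i       ≡⟨ xor-assoc (bit i (a t)) (δ i) (δ i) ⟩
      bit i (a t) xor (δ i xor δ i)       ≡⟨ cong (bit i (a t) xor_) (xor-same (δ i)) ⟩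
      bit i (a t) xor false               ≡⟨ xor-identityʳ (bit i (a t)) ⟩
      bit i (a t)                         ∎)
      where
      open ≡.≡-Reasoning
      δ : Fin k → Bool
      δ i = does (i ≟ p)

    -- ↓(∂ atom i) = { x | atom i ⋢ x }
    coatomIdeal : Fin k → SubsetB B e
    coatomIdeal i = tabulate (λ t → not (bit i (a t)))

    lookup-coatomIdeal : ∀ i t → lookup (coatomIdeal i) t ≡ not (bit i (a t))
    lookup-coatomIdeal i = lookup∘tabulate _

    ∈-coatomIdeal⁻ : ∀ i t → _∈B_ B e t (coatomIdeal i) → bit i (a t) ≡ false
    ∈-coatomIdeal⁻ i t t∈ = not-injective (≡.trans (≡.sym (lookup-coatomIdeal i t)) t∈)

    ∈-coatomIdeal⁺ : ∀ i t → bit i (a t) ≡ false → _∈B_ B e t (coatomIdeal i)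
    ∈-coatomIdeal⁺ i t bitᵢ = ≡.trans (lookup-coatomIdeal i t) (cong not bitᵢ)

    coatomIdeal-isIdeal : ∀ i → IsIdeal B e (coatomIdeal i)
    coatomIdeal-isIdeal i = record
      { nonempty = idx 𝟘 , ∈-coatomIdeal⁺ i _ (≡.trans (bit-resp i (a-idx 𝟘)) (bit-𝟘 i))
      ; downward = λ s t t⊑s s∈ → ∈-coatomIdeal⁺ i t (dec-false (atom i ⊑? a t) λ i⊑t →
          not-¬ (dec-true (atom i ⊑? a s) (⊑-trans i⊑t (≤B⇒⊑ t⊑s))) (∈-coatomIdeal⁻ i s s∈))
      ; joins = λ s t u s∈ t∈ u≈s∨t → ∈-coatomIdeal⁺ i u (begin
          bit i (a u)                ≡⟨ bit-resp i u≈s∨t ⟩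
          bit i (a s ∨ a t)          ≡⟨ bit-∨ i (a s) (a t) ⟩
          bit i (a s) Bool.∨ bit i (a t) ≡⟨ ≡.cong₂ Bool._∨_ (∈-coatomIdeal⁻ i s s∈) (∈-coatomIdeal⁻ i t t∈) ⟩
          false                      ∎)
      }
      where open ≡.≡-Reasoning

    coatomIdeal-toggle : ∀ i p t →
      lookup (coatomIdeal i) (toggle p t) ≡ lookup (coatomIdeal i) t xor does (i ≟ p)
    coatomIdeal-toggle i p t = begin
      lookup (coatomIdeal i) (toggle p t)         ≡⟨ lookup-coatomIdeal i (toggle p t) ⟩
      not (bit i (a (toggle p t)))                ≡⟨ cong not (bit-toggle p t i) ⟩
      not (bit i (a t) xor does (i ≟ p))          ≡⟨ not-distribˡ-xor (bit i (a t)) (does (i ≟ p)) ⟩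
      not (bit i (a t)) xor does (i ≟ p)          ≡⟨ cong (_xor does (i ≟ p)) (lookup-coatomIdeal i t) ⟨
      lookup (coatomIdeal i) t xor does (i ≟ p)   ∎
      where open ≡.≡-Reasoning

    coatomIdeal-weight : ∀ i → 2 * weight (coatomIdeal i) ≡ N
    coatomIdeal-weight i = weight-half (toggle i) (toggle-involutive i) (coatomIdeal i) λ t → begin
      lookup (coatomIdeal i) (toggle i t)          ≡⟨ coatomIdeal-toggle i i t ⟩
      lookup (coatomIdeal i) t xor does (i ≟ i)    ≡⟨ cong (lookup (coatomIdeal i) t xor_) (dec-true (i ≟ i) ≡.refl) ⟩
      lookup (coatomIdeal i) t xor true            ≡⟨ xor-comm _ true ⟩
      not (lookup (coatomIdeal i) t)               ∎
      where open ≡.≡-Reasoning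

    coatomIdeal-injective : ∀ i j → coatomIdeal i ≡ coatomIdeal j → i ≡ j
    coatomIdeal-injective i j eq =
      ≡.sym (atom⊑atom⇒≡ j i (⊑-respʳ-≈ (a-idx (atom i)) (dec-true⁻¹ (atom j ⊑? a t) bitⱼ)))
      where
      t : Fin N
      t = idx (atom i)
      bitᵢ : bit i (a t) ≡ true
      bitᵢ = ≡.trans (bit-resp i (a-idx (atom i))) (dec-true (atom i ⊑? atom i) ⊑-refl)
      bitⱼ : bit j (a t) ≡ true
      bitⱼ = ≡.trans (not-injective (begin
        not (bit j (a t))          ≡⟨ lookup-coatomIdeal j t ⟨
        lookup (coatomIdeal j) t   ≡⟨ cong (λ I → lookup I t) eq ⟨
        lookup (coatomIdeal i) t   ≡⟨ lookup-coatomIdeal i t ⟩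
        not (bit i (a t))          ∎)) bitᵢ
        where open ≡.≡-Reasoning

    half-ideal⇒coatomIdeal : ∀ J → IsIdeal B e J → 2 * weight J ≡ N → ∃ λ i → coatomIdeal i ≡ J
    half-ideal⇒coatomIdeal J J-ideal J-half with atom-below Q-resp ¬Q𝟘 Q-join 𝟙 Q𝟙
      where
      open IsIdeal J-ideal
      Q : Carrier → Set
      Q y = lookup J (idx y) ≡ false
      Q-resp : ∀ {x y} → x ≈ y → Q x → Q y
      Q-resp x≈y = ≡.trans (cong (lookup J) (≡.sym (idx-resp x≈y)))
      ¬Q𝟘 : ¬ Q 𝟘
      ¬Q𝟘 = not-¬ (downward s (idx 𝟘) (⊑⇒≤B (⊑-respˡ-≈ (sym (a-idx 𝟘)) (𝟘⊑ (a s)))) (proj₂ nonempty))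
        where
        s : Fin N
        s = proj₁ nonempty
      Q-join : ∀ y z → Q (y ∨ z) → Q y ⊎ Q z
      Q-join y z Qy∨z with lookup J (idx y) Bool.≟ false | lookup J (idx z) Bool.≟ false
      ... | yes Qy | _      = inj₁ Qy
      ... | no _   | yes Qz = inj₂ Qz
      ... | no ¬Qy | no ¬Qz = contradiction Qy∨z (not-¬ (joins (idx y) (idx z) (idx (y ∨ z)) (¬-not ¬Qy) (¬-not ¬Qz)
                                (trans (a-idx (y ∨ z)) (sym (∨-cong (a-idx y) (a-idx z))))))
      -- 𝟙 ∈ J would give J = B, and 2 · 2ⁿ ≢ 2ⁿ.
      Q𝟙 : Q 𝟙
      Q𝟙 = ¬-not λ 𝟙∈J → contradiction (ℕ.*-cancelʳ-≡ 2 1 N ⦃ ℕ.m^n≢0 2 n ⦄ (2N≡1N 𝟙∈J)) λ ()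
        where
        2N≡1N : lookup J (idx 𝟙) ≡ true → 2 * N ≡ 1 * N
        2N≡1N 𝟙∈J = begin
          2 * N          ≡⟨ cong (2 *_) (weight-all J all∈J) ⟨
          2 * weight J   ≡⟨ J-half ⟩
          N              ≡⟨ ℕ.*-identityˡ N ⟨
          1 * N          ∎
          where
          open ≡.≡-Reasoning
          all∈J : ∀ t → lookup J t ≡ true
          all∈J t = downward (idx 𝟙) t (⊑⇒≤B (⊑-respʳ-≈ (sym (a-idx 𝟙)) (⊑𝟙 (a t)))) 𝟙∈J
    ... | p , p-atom , _ , p∉J =
      i , ≡.sym (weight-⊆-≡ J⊆ (ℕ.*-cancelˡ-≡ _ _ 2 (≡.trans J-half (≡.sym (coatomIdeal-weight i)))))
      where
      open IsIdeal J-ideal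
      i : Fin k
      i = proj₁ (atom-index p-atom)
      p⊑ : ∀ {x} → atom i ⊑ x → p ⊑ x
      p⊑ = ⊑-respˡ-≈ (proj₂ (atom-index p-atom))
      J⊆ : lookup J ⊆ lookup (coatomIdeal i)
      J⊆ t t∈J = ∈-coatomIdeal⁺ i t (dec-false (atom i ⊑? a t) λ i⊑t →
        not-¬ (downward t (idx p) (⊑⇒≤B (⊑-respˡ-≈ (sym (a-idx p)) (p⊑ i⊑t))) t∈J) p∉J)

    half-ideals-combination-weight : ∀ {m} (Is : Fin m → SubsetB B e) → (∀ i j → Is i ≡ Is j → i ≡ j) →
      (∀ j → IsIdeal B e (Is j) × 2 * weight (Is j) ≡ N) →
      ∀ ls i₀ → ls i₀ ≡ true → 2 * weight (lincomb ls (λ j → codeword B e (Is j))) ≡ N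
    half-ideals-combination-weight {m} Is Is-injective Is-half ls i₀ lsᵢ₀ =
      weight-half (toggle p) (toggle-involutive p) (lincomb ls vs) flips
      where
      π-spec : ∀ j → ∃ λ i → coatomIdeal i ≡ Is j
      π-spec j = half-ideal⇒coatomIdeal (Is j) (proj₁ (Is-half j)) (proj₂ (Is-half j))
      π : Fin m → Fin k
      π j = proj₁ (π-spec j)
      π-injective : ∀ i j → π i ≡ π j → i ≡ j
      π-injective i j πi≡πj =
        Is-injective i j (≡.trans (≡.sym (proj₂ (π-spec i))) (≡.trans (cong coatomIdeal πi≡πj) (proj₂ (π-spec j))))
      vs : Fin m → Word N
      vs j = codeword B e (Is j)
      lookup-vs : ∀ j → lookup (vs j) ≗ lookup (coatomIdeal (π j))
      lookup-vs j t = ≡.trans (lookup∘tabulate _ t) (cong (λ I → lookup I t) (≡.sym (proj₂ (π-spec j))))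
      p : Fin k
      p = π i₀
      g : Fin N → Bool
      g = lookup (lincomb ls vs)
      δ : Fin m → Bool
      δ j = does (π j ≟ p)
      selected : ℤ₂.sum (λ j → ls j Bool.∧ δ j) ≡ true
      selected = ≡.trans (sum-select ℤ₂-monoid _ i₀ others) (≡.cong₂ Bool._∧_ lsᵢ₀ (dec-true (p ≟ p) ≡.refl))
        where
        others : ∀ j → j ≢ i₀ → ls j Bool.∧ δ j ≡ false
        others j j≢i₀ =
          ≡.trans (cong (ls j Bool.∧_) (dec-false (π j ≟ p) (j≢i₀ ∘ π-injective j i₀))) (BoolProperties.∧-zeroʳ (ls j))
      flips : ∀ t → g (toggle p t) ≡ not (g t)
      flips t = begin
        g (toggle p t)                            ≡⟨ lookup-lincomb-shift ls vs δ (toggle p t) t shift ⟩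
        g t xor ℤ₂.sum (λ j → ls j Bool.∧ δ j)   ≡⟨ cong (g t xor_) selected ⟩
        g t xor true                              ≡⟨ xor-comm (g t) true ⟩
        not (g t)                                 ∎
        where
        open ≡.≡-Reasoning
        shift : ∀ j → lookup (vs j) (toggle p t) ≡ lookup (vs j) t xor δ j
        shift j = ≡.trans (lookup-vs j (toggle p t))
                    (≡.trans (coatomIdeal-toggle (π j) p t) (cong (_xor δ j) (≡.sym (lookup-vs j t))))

    halfIdeal : Fin n → SubsetB B e
    halfIdeal i = coatomIdeal (cast (≡.sym atoms-count) i)

    halfIdeal-injective : ∀ i j → halfIdeal i ≡ halfIdeal j → i ≡ j
    halfIdeal-injective i j eq = ≡.trans (≡.sym (cast-involutive atoms-count (≡.sym atoms-count) i))
      (≡.trans (cong (cast atoms-count) (coatomIdeal-injective _ _ eq)) (cast-involutive atoms-count (≡.sym atoms-count) j))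

    halfIdeal-isHalf : ∀ i → IsIdeal B e (halfIdeal i) × 2 * weight (halfIdeal i) ≡ N
    halfIdeal-isHalf i = coatomIdeal-isIdeal _ , coatomIdeal-weight _

    halfIdeal-complete : ∀ J → IsIdeal B e J → 2 * weight J ≡ N → ∃ λ i → halfIdeal i ≡ J
    halfIdeal-complete J J-ideal J-half =
      cast atoms-count i , ≡.trans (cong coatomIdeal (cast-involutive (≡.sym atoms-count) atoms-count i)) Jᵢ≡J
      where
      i : Fin k
      i = proj₁ (half-ideal⇒coatomIdeal J J-ideal J-half)
      Jᵢ≡J : coatomIdeal i ≡ J
      Jᵢ≡J = proj₂ (half-ideal⇒coatomIdeal J J-ideal J-half)

    hadamard-code : 1 ≤ n → (Is : Fin n → SubsetB B e) → (∀ i j → Is i ≡ Is j → i ≡ j) →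
      (∀ i → IsIdeal B e (Is i) × 2 * weight (Is i) ≡ N) →
      IsLinearCode (Span (λ i → codeword B e (Is i))) ×
      HasDimension (Span (λ i → codeword B e (Is i))) n ×
      HasMinDistance (Span (λ i → codeword B e (Is i))) (2 ^ (n ∸ 1))
    hadamard-code n≥1 Is Is-injective Is-half =
      Span-isLinearCode vs , (vs , linIndep , λ _ → mk⇔ id id) , hasMinDistance (fromℕ< n≥1)
      where
      vs : Fin n → Word N
      vs i = codeword B e (Is i)
      weight-lincomb : ∀ ls i → ls i ≡ true → weight (lincomb ls vs) ≡ 2 ^ (n ∸ 1)
      weight-lincomb ls i lsᵢ = ℕ.*-cancelˡ-≡ _ _ 2
        (≡.trans (half-ideals-combination-weight Is Is-injective Is-half ls i lsᵢ) (≡.sym (2*2^[n∸1]≡2^n n≥1)))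
      open ConstantWeight vs (ℕ.m^n>0 2 (n ∸ 1)) weight-lincomb

open FiniteBooleanAlgebras

open import Data.Nat using (z≤n; s≤s)
open import Data.Nat.Properties using (≤-trans)
open import Data.Product using (_,_)

theorem2 : ∀ {c ℓ} (B : BooleanAlgebra c ℓ) (n : ℕ) (e : Enumeration B n) →
    (Σ (Fin n → SubsetB B e) λ Is →
        (∀ i j → Is i ≡ Is j → i ≡ j) ×
        (∀ i → IsIdeal B e (Is i) × 2 * weight (Is i) ≡ 2 ^ n) ×
        (∀ J → IsIdeal B e J → 2 * weight J ≡ 2 ^ n → ∃ λ i → Is i ≡ J))
    ×
    (2 ≤ n → (Is : Fin n → SubsetB B e) →
        (∀ i j → Is i ≡ Is j → i ≡ j) →
        (∀ i → IsIdeal B e (Is i) × 2 * weight (Is i) ≡ 2 ^ n) →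
        (∀ J → IsIdeal B e J → 2 * weight J ≡ 2 ^ n → ∃ λ i → Is i ≡ J) →
        IsLinearCode (Span (λ i → codeword B e (Is i))) ×
        HasDimension (Span (λ i → codeword B e (Is i))) n ×
        HasMinDistance (Span (λ i → codeword B e (Is i))) (2 ^ (n ∸ 1)))
-- Distinct half-size ideals are automatically all of them.
theorem2 B n e =
  (halfIdeal , halfIdeal-injective , halfIdeal-isHalf , halfIdeal-complete) ,
  λ n≥2 Is Is-injective Is-half _ → hadamard-code (≤-trans (s≤s z≤n) n≥2) Is Is-injective Is-half
  where open FiniteBooleanAlgebra B e
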